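{- An intuitionistic sequent $S$ is provable in $\mathsf{NIQ}(\mathrm{ID})$ if and only if it is provable in $\mathsf{LBIQ}(\mathrm{ID})$.
   Context: Syntax. Terms are built from variables and function symbols (constants have arity $0$); $\mathrm{Ter}(X)$ is the set of terms whose variables lie in $X$ (contains all constants), $\mathrm{Ter}=\mathrm{Ter}(\mathrm{Var})$, $\mathrm{VT}(t)$ the variables of $t$, $\mathrm{VT}(t_1,\dots,t_n)=\bigcup_i\mathrm{VT}(t_i)$. Formulae: $\varphi::=p(\vec t)\mid\bot\mid\top\mid\varphi\wedge\varphi\mid\varphi\vee\varphi\mid\varphi\mathbin{ -\!\!<}\varphi\mid\varphi\to\varphi\mid\exists x\varphi\mid\forall x\varphi$ ($\mathbin{ -\!\!<}$ is exclusion); intuitionistic formulae are those without $\mathbin{ -\!\!<}$. $\varphi(t/x)$ is capture-avoiding substitution. Sequents. Labeled formula $w:\varphi$, relational atom $wRu$, domain atom $w:x$. A sequent is $\mathcal R,\mathcal T,\Gamma\vdash\Delta$ ($\mathcal R$ finite multiset of relational atoms, $\mathcal T$ of domain atoms, $\Gamma,\Delta$ of labeled formulae) such that (1) if $\mathcal R\ne\emptyset$ every label in $\mathcal T,\Gamma,\Delta$ occurs in $\mathcal R$, and if $\mathcal R=\emptyset$ exactly one label occurs; (2) the directed graph of $\mathcal R$ is connected without directed or undirected cycles. $w\twoheadrightarrow^*_{\mathcal R}u$ iff $w=u$ or there is a chain $wRv_1,\dots,v_nRu$ in $\mathcal R$. $X_w=\{x\mid u:x\in\mathcal T,\ u\twoheadrightarrow^*_{\mathcal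 R}w\}$; $t$ is available for $w$ iff $t\in\mathrm{Ter}(X_w)$. Fresh = not occurring in the conclusion. A sequent is intuitionistic iff $\mathcal R$ is a directed tree rooted at some label (single label if $\mathcal R=\emptyset$), every formula in it is intuitionistic, for every $w:\varphi$ in it every free variable $x$ of $\varphi$ is available for $w$, and $w:x,z:x\in\mathcal T$ implies $w=z$. $\mathsf{LBIQ}(\mathrm{ID})$ (premises$\,/\,$conclusion, unchanged parts omitted, side conditions evaluated in the conclusion): (ax) $\Gamma,w:p(\vec t)\vdash\Delta,u:p(\vec t)$ if $w\twoheadrightarrow^*_{\mathcal R}u$; $(\bot L)$ $\Gamma,w:\bot\vdash\Delta$; $(\top R)$ $\Gamma\vdash\Delta,w:\top$; $(\wedge L)$ $\Gamma,w:\varphi,w:\psi\vdash\Delta\,/\,\Gamma,w:\varphi\wedge\psi\vdash\Delta$; $(\wedge R)$ $\Gamma\vdash\Delta,w:\varphi$ and $\Gamma\vdash\Delta,w:\psi\,/\,\Gamma\vdash\Delta,w:\varphi\wedge\psi$; $(\vee L)$ $\Gamma,w:\varphi\vdash\Delta$ and $\Gamma,w:\psi\vdash\Delta\,/\,\Gamma,w:\varphi\vee\psi\vdash\Delta$; $(\vee R)$ $\Gamma\vdash\Delta,w:\varphi,w:\psi\,/\,\Gamma\vdash\Delta,w:\varphi\vee\psi$; $(\to L)$ $\Gamma,w:\varphi\to\psi\vdash\Delta,u:\varphi$ and $\Gamma,w:\varphi\to\psi,u:\psi\vdash\Delta\,/\,\Gamma,w:\varphi\to\psi\vdash\Delta$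 if $w\twoheadrightarrow^*_{\mathcal R}u$; $(\to R)$ $\mathcal R,wRu,\mathcal T,\Gamma,u:\varphi\vdash\Delta,u:\psi\,/\,\mathcal R,\mathcal T,\Gamma\vdash\Delta,w:\varphi\to\psi$, $u$ fresh; $(\mathbin{ -\!\!<}L)$ $\mathcal R,uRw,\mathcal T,\Gamma,u:\varphi\vdash\Delta,u:\psi\,/\,\mathcal R,\mathcal T,\Gamma,w:\varphi\mathbin{ -\!\!<}\psi\vdash\Delta$, $u$ fresh; $(\mathbin{ -\!\!<}R)$ $\Gamma\vdash\Delta,u:\varphi\mathbin{ -\!\!<}\psi,w:\varphi$ and $\Gamma,w:\psi\vdash\Delta,u:\varphi\mathbin{ -\!\!<}\psi\,/\,\Gamma\vdash\Delta,u:\varphi\mathbin{ -\!\!<}\psi$ if $w\twoheadrightarrow^*_{\mathcal R}u$; $(\exists L)$ $\mathcal R,\mathcal T,w:y,\Gamma,w:\varphi(y/x)\vdash\Delta\,/\,\mathcal R,\mathcal T,\Gamma,w:\exists x\varphi\vdash\Delta$, $y$ fresh; $(\exists R)$ $\Gamma\vdash\Delta,w:\exists x\varphi,w:\varphi(t/x)\,/\,\Gamma\vdash\Delta,w:\exists x\varphi$ if $t$ available for $w$; $(\forall L)$ $\Gamma,w:\forall x\varphi,u:\varphi(t/x)\vdash\Delta\,/\,\Gamma,w:\forall x\varphi\vdash\Delta$ if $w\twoheadrightarrow^*_{\mathcal R}u$ and $t$ available for $u$; $(\forall R)$ $\mathcal R,wRu,\mathcal T,u:y,\Gamma\vdash\Delta,u:\varphi(y/x)\,/\,\mathcal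 R,\mathcal T,\Gamma\vdash\Delta,w:\forall x\varphi$, $u,y$ fresh; $(ds)$ $\mathcal R,\mathcal T,w:\mathrm{VT}(\vec t),\Gamma,w:p(\vec t)\vdash\Delta\,/\,\mathcal R,\mathcal T,\Gamma,w:p(\vec t)\vdash\Delta$ ($w:\mathrm{VT}(\vec t)$ = atoms $w:x$, $x\in\mathrm{VT}(\vec t)$). Proofs are finite trees of rule instances with leaves (ax), $(\bot L)$, $(\top R)$; sequents differing by a bijective label renaming are regarded as mutually derivable. $\mathsf{NIQ}(\mathrm{ID})$ is $\mathsf{LBIQ}(\mathrm{ID})$ without $(ds)$ restricted to intuitionistic sequents (every sequent in a proof is intuitionistic). -}

module Defs where

open import Data.Nat using (ℕ; zero; suc)
open import Data.Fin using (Fin; zero; suc; inject₁)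
open import Data.List using (List; []; _∷_; _++_; map; concatMap; length; lookup)
open import Data.List.Membership.Propositional using (_∈_; _∉_)
open import Data.List.Relation.Binary.Permutation.Propositional using (_↭_)
open import Data.Product using (Σ; ∃; ∃-syntax; _×_; _,_; proj₁; proj₂)
open import Data.Sum using (_⊎_)
open import Data.Bool using (Bool; true; false)
open import Data.Empty using (⊥)
open import Data.Unit using (⊤)
open import Relation.Nullary using (¬_)
open import Relation.Binary.PropositionalEquality using (_≡_)
open import Relation.Binary.Construct.Closure.ReflexiveTransitive using (Star)
open import Function.Definitions using (Injective)

-- Syntax (locally nameless: free variables are names in ℕ, bound
-- variables are well-scoped de Bruijn indices).  A universal first-order
-- language: function symbols and predicate symbols are named by ℕ and may
-- be applied to any list of arguments (constants = arity 0).

Var Label FunSym PredSym : Set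
Var = ℕ
Label = ℕ
FunSym = ℕ
PredSym = ℕ

data Tm (n : ℕ) : Set where
  var  : Var → Tm n
  bvar : Fin n → Tm n
  fun  : FunSym → List (Tm n) → Tm n

data Fm (n : ℕ) : Set where
  atom : PredSym → List (Tm n) → Fm n
  ⊥ᶠ ⊤ᶠ : Fm n
  _∧ᶠ_ _∨ᶠ_ _-<_ _⇒_ : Fm n → Fm n → Fm n
  ∃ᶠ ∀ᶠ : Fm (suc n) → Fm n

Term : Set
Term = Tm 0

Formula : Set
Formula = Fm 0

mutual
  renT : ∀ {n m} → (Fin n → Fin m) → Tm n → Tm m
  renT ρ (var x) = var x
  renT ρ (bvar i) = bvar (ρ i)
  renT ρ (fun f ts) = fun f (renTs ρ ts)

  renTs : ∀ {n m} → (Fin n → Fin m) → List (Tm n) → List (Tm m)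
  renTs ρ [] = []
  renTs ρ (t ∷ ts) = renT ρ t ∷ renTs ρ ts

mutual
  subT : ∀ {n m} → (Fin n → Tm m) → Tm n → Tm m
  subT σ (var x) = var x
  subT σ (bvar i) = σ i
  subT σ (fun f ts) = fun f (subTs σ ts)

  subTs : ∀ {n m} → (Fin n → Tm m) → List (Tm n) → List (Tm m)
  subTs σ [] = []
  subTs σ (t ∷ ts) = subT σ t ∷ subTs σ ts

lift : ∀ {n m} → (Fin n → Tm m) → Fin (suc n) → Tm (suc m)
lift σ zero = bvar zero
lift σ (suc i) = renT suc (σ i)

subF : ∀ {n m} → (Fin n → Tm m) → Fm n → Fm m
subF σ (atom p ts) = atom p (subTs σ ts)
subF σ ⊥ᶠ = ⊥ᶠ
subF σ ⊤ᶠ = ⊤ᶠ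
subF σ (φ ∧ᶠ ψ) = subF σ φ ∧ᶠ subF σ ψ
subF σ (φ ∨ᶠ ψ) = subF σ φ ∨ᶠ subF σ ψ
subF σ (φ -< ψ) = subF σ φ -< subF σ ψ
subF σ (φ ⇒ ψ) = subF σ φ ⇒ subF σ ψ
subF σ (∃ᶠ φ) = ∃ᶠ (subF (lift σ) φ)
subF σ (∀ᶠ φ) = ∀ᶠ (subF (lift σ) φ)

-- φ(t/x) for the body φ of a quantifier ∃xφ / ∀xφ (capture-free)
_[_] : Fm 1 → Term → Formula
φ [ t ] = subF (λ _ → t) φ

mutual
  VT : ∀ {n} → Tm n → List Var
  VT (var x) = x ∷ []
  VT (bvar i) = []
  VT (fun f ts) = VTs ts

  VTs : ∀ {n} → List (Tm n) → List Var
  VTs [] = []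
  VTs (t ∷ ts) = VT t ++ VTs ts

FV : ∀ {n} → Fm n → List Var
FV (atom p ts) = VTs ts
FV ⊥ᶠ = []
FV ⊤ᶠ = []
FV (φ ∧ᶠ ψ) = FV φ ++ FV ψ
FV (φ ∨ᶠ ψ) = FV φ ++ FV ψ
FV (φ -< ψ) = FV φ ++ FV ψ
FV (φ ⇒ ψ) = FV φ ++ FV ψ
FV (∃ᶠ φ) = FV φ
FV (∀ᶠ φ) = FV φ

IntFm : ∀ {n} → Fm n → Set
IntFm (atom p ts) = ⊤
IntFm ⊥ᶠ = ⊤
IntFm ⊤ᶠ = ⊤
IntFm (φ ∧ᶠ ψ) = IntFm φ × IntFm ψ
IntFm (φ ∨ᶠ ψ) = IntFm φ × IntFm ψ
IntFm (φ -< ψ) = ⊥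
IntFm (φ ⇒ ψ) = IntFm φ × IntFm ψ
IntFm (∃ᶠ φ) = IntFm φ
IntFm (∀ᶠ φ) = IntFm φ

-- Sequents  R, T, Γ ⊢ Δ  (multisets represented by lists; rules below
-- work up to permutation, so lists behave as multisets)

RelAtom DomAtom LFm : Set
RelAtom = Label × Label      -- (w , u) is  wRu
DomAtom = Label × Var        -- (w , x) is  w:x
LFm = Label × Formula        -- (w , φ) is  w:φ

record Seq : Set where
  constructor ⟨_,_,_⊢_⟩
  field
    R : List RelAtom
    T : List DomAtom
    Γ : List LFm
    Δ : List LFm
open Seq public

labelsR : List RelAtom → List Label
labelsR = concatMap (λ e → proj₁ e ∷ proj₂ e ∷ [])

labelsTΓΔ : Seq → List Label
labelsTΓΔ S = map proj₁ (T S) ++ map proj₁ (Γ S) ++ map proj₁ (Δ S)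

labels : Seq → List Label
labels S = labelsR (R S) ++ labelsTΓΔ S

vars : Seq → List Var
vars S = map proj₂ (T S) ++ concatMap (λ a → FV (proj₂ a)) (Γ S ++ Δ S)

FreshLabel : Label → Seq → Set
FreshLabel u S = u ∉ labels S

FreshVar : Var → Seq → Set
FreshVar y S = y ∉ vars S

Reach : List RelAtom → Label → Label → Set
Reach R = Star (λ a b → (a , b) ∈ R)

InX : Seq → Label → Var → Set
InX S w x = ∃[ u ] ((u , x) ∈ T S × Reach (R S) u w)

Available : Seq → Term → Label → Set
Available S t w = ∀ x → x ∈ VT t → InX S w x

Joins : (R : List RelAtom) → Fin (length R) → Label → Label → Set
Joins R i a b = (lookup R i ≡ (a , b)) ⊎ (lookup R i ≡ (b , a))

UndirectedCycle : List RelAtom → Set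
UndirectedCycle R =
  Σ ℕ λ k → Σ (Fin (suc (suc k)) → Label) λ v → Σ (Fin (suc k) → Fin (length R)) λ e →
    (v zero ≡ v (Data.Fin.fromℕ (suc k)))
    × Injective _≡_ _≡_ (λ i → v (inject₁ i))
    × Injective _≡_ _≡_ e
    × (∀ i → Joins R (e i) (v (inject₁ i)) (v (suc i)))

DirectedCycle : List RelAtom → Set
DirectedCycle R =
  Σ ℕ λ k → Σ (Fin (suc (suc k)) → Label) λ v → Σ (Fin (suc k) → Fin (length R)) λ e →
    (v zero ≡ v (Data.Fin.fromℕ (suc k)))
    × Injective _≡_ _≡_ (λ i → v (inject₁ i))
    × Injective _≡_ _≡_ e
    × (∀ i → lookup R (e i) ≡ (v (inject₁ i) , v (suc i)))

Connected : List RelAtom → Set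
Connected R = ∀ a b → a ∈ labelsR R → b ∈ labelsR R →
  Star (λ x y → (x , y) ∈ R ⊎ (y , x) ∈ R) a b

LabelCond : Seq → Set
LabelCond S with R S
... | [] = ∃[ w ] (w ∈ labelsTΓΔ S × (∀ v → v ∈ labelsTΓΔ S → v ≡ w))
... | _ ∷ _ = ∀ w → w ∈ labelsTΓΔ S → w ∈ labelsR (R S)

IsSequent : Seq → Set
IsSequent S = LabelCond S × Connected (R S)
  × ¬ DirectedCycle (R S) × ¬ UndirectedCycle (R S)

-- R is a directed tree rooted at some label: the underlying graph is a
-- tree (from IsSequent) and every label of R is reachable from the root
-- (for R = ∅ the single-label requirement is part of IsSequent)
RootedTree : List RelAtom → Set
RootedTree R = ∃[ r ] (∀ v → v ∈ labelsR R → Reach R r v)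

IsIntuitionistic : Seq → Set
IsIntuitionistic S = IsSequent S × RootedTree (R S)
  × (∀ w φ → (w , φ) ∈ Γ S ++ Δ S → IntFm φ)
  × (∀ w φ x → (w , φ) ∈ Γ S ++ Δ S → x ∈ FV φ → InX S w x)
  × (∀ w z x → (w , x) ∈ T S → (z , x) ∈ T S → w ≡ z)

-- The calculus.  Der ds? Ok S : S is provable using only sequents
-- satisfying Ok; the rule (ds) is available iff ds? ≡ true.

domAtoms : Label → List Term → List DomAtom
domAtoms w ts = map (λ x → (w , x)) (VTs ts)

data Der (ds? : Bool) (Ok : Seq → Set) : Seq → Set where
  ax : ∀ {R T Γ Δ w u p ts} → Ok ⟨ R , T , Γ ⊢ Δ ⟩ →
       (w , atom p ts) ∈ Γ → (u , atom p ts) ∈ Δ → Reach R w u →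
       Der ds? Ok ⟨ R , T , Γ ⊢ Δ ⟩
  ⊥L : ∀ {R T Γ Δ w} → Ok ⟨ R , T , Γ ⊢ Δ ⟩ →
       (w , ⊥ᶠ) ∈ Γ → Der ds? Ok ⟨ R , T , Γ ⊢ Δ ⟩
  ⊤R : ∀ {R T Γ Δ w} → Ok ⟨ R , T , Γ ⊢ Δ ⟩ →
       (w , ⊤ᶠ) ∈ Δ → Der ds? Ok ⟨ R , T , Γ ⊢ Δ ⟩
  ∧L : ∀ {R T Γ Γ₀ Δ w φ ψ} → Ok ⟨ R , T , Γ ⊢ Δ ⟩ →
       Γ ↭ (w , φ ∧ᶠ ψ) ∷ Γ₀ →
       Der ds? Ok ⟨ R , T , (w , φ) ∷ (w , ψ) ∷ Γ₀ ⊢ Δ ⟩ →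
       Der ds? Ok ⟨ R , T , Γ ⊢ Δ ⟩
  ∧R : ∀ {R T Γ Δ Δ₀ w φ ψ} → Ok ⟨ R , T , Γ ⊢ Δ ⟩ →
       Δ ↭ (w , φ ∧ᶠ ψ) ∷ Δ₀ →
       Der ds? Ok ⟨ R , T , Γ ⊢ (w , φ) ∷ Δ₀ ⟩ →
       Der ds? Ok ⟨ R , T , Γ ⊢ (w , ψ) ∷ Δ₀ ⟩ →
       Der ds? Ok ⟨ R , T , Γ ⊢ Δ ⟩
  ∨L : ∀ {R T Γ Γ₀ Δ w φ ψ} → Ok ⟨ R , T , Γ ⊢ Δ ⟩ →
       Γ ↭ (w , φ ∨ᶠ ψ) ∷ Γ₀ →
       Der ds? Ok ⟨ R , T , (w , φ) ∷ Γ₀ ⊢ Δ ⟩ →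
       Der ds? Ok ⟨ R , T , (w , ψ) ∷ Γ₀ ⊢ Δ ⟩ →
       Der ds? Ok ⟨ R , T , Γ ⊢ Δ ⟩
  ∨R : ∀ {R T Γ Δ Δ₀ w φ ψ} → Ok ⟨ R , T , Γ ⊢ Δ ⟩ →
       Δ ↭ (w , φ ∨ᶠ ψ) ∷ Δ₀ →
       Der ds? Ok ⟨ R , T , Γ ⊢ (w , φ) ∷ (w , ψ) ∷ Δ₀ ⟩ →
       Der ds? Ok ⟨ R , T , Γ ⊢ Δ ⟩
  ⇒L : ∀ {R T Γ Δ w u φ ψ} → Ok ⟨ R , T , Γ ⊢ Δ ⟩ →
       (w , φ ⇒ ψ) ∈ Γ → Reach R w u →
       Der ds? Ok ⟨ R , T , Γ ⊢ (u , φ) ∷ Δ ⟩ →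
       Der ds? Ok ⟨ R , T , (u , ψ) ∷ Γ ⊢ Δ ⟩ →
       Der ds? Ok ⟨ R , T , Γ ⊢ Δ ⟩
  ⇒R : ∀ {R T Γ Δ Δ₀ w u φ ψ} → Ok ⟨ R , T , Γ ⊢ Δ ⟩ →
       Δ ↭ (w , φ ⇒ ψ) ∷ Δ₀ → FreshLabel u ⟨ R , T , Γ ⊢ Δ ⟩ →
       Der ds? Ok ⟨ (w , u) ∷ R , T , (u , φ) ∷ Γ ⊢ (u , ψ) ∷ Δ₀ ⟩ →
       Der ds? Ok ⟨ R , T , Γ ⊢ Δ ⟩
  -<L : ∀ {R T Γ Γ₀ Δ w u φ ψ} → Ok ⟨ R , T , Γ ⊢ Δ ⟩ →
       Γ ↭ (w , φ -< ψ) ∷ Γ₀ → FreshLabel u ⟨ R , T , Γ ⊢ Δ ⟩ →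
       Der ds? Ok ⟨ (u , w) ∷ R , T , (u , φ) ∷ Γ₀ ⊢ (u , ψ) ∷ Δ ⟩ →
       Der ds? Ok ⟨ R , T , Γ ⊢ Δ ⟩
  -<R : ∀ {R T Γ Δ w u φ ψ} → Ok ⟨ R , T , Γ ⊢ Δ ⟩ →
       (u , φ -< ψ) ∈ Δ → Reach R w u →
       Der ds? Ok ⟨ R , T , Γ ⊢ (w , φ) ∷ Δ ⟩ →
       Der ds? Ok ⟨ R , T , (w , ψ) ∷ Γ ⊢ Δ ⟩ →
       Der ds? Ok ⟨ R , T , Γ ⊢ Δ ⟩
  ∃L : ∀ {R T Γ Γ₀ Δ w y φ} → Ok ⟨ R , T , Γ ⊢ Δ ⟩ →
       Γ ↭ (w , ∃ᶠ φ) ∷ Γ₀ → FreshVar y ⟨ R , T , Γ ⊢ Δ ⟩ →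
       Der ds? Ok ⟨ R , (w , y) ∷ T , (w , φ [ var y ]) ∷ Γ₀ ⊢ Δ ⟩ →
       Der ds? Ok ⟨ R , T , Γ ⊢ Δ ⟩
  ∃R : ∀ {R T Γ Δ w φ t} → Ok ⟨ R , T , Γ ⊢ Δ ⟩ →
       (w , ∃ᶠ φ) ∈ Δ → Available ⟨ R , T , Γ ⊢ Δ ⟩ t w →
       Der ds? Ok ⟨ R , T , Γ ⊢ (w , φ [ t ]) ∷ Δ ⟩ →
       Der ds? Ok ⟨ R , T , Γ ⊢ Δ ⟩
  ∀L : ∀ {R T Γ Δ w u φ t} → Ok ⟨ R , T , Γ ⊢ Δ ⟩ →
       (w , ∀ᶠ φ) ∈ Γ → Reach R w u → Available ⟨ R , T , Γ ⊢ Δ ⟩ t u →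
       Der ds? Ok ⟨ R , T , (u , φ [ t ]) ∷ Γ ⊢ Δ ⟩ →
       Der ds? Ok ⟨ R , T , Γ ⊢ Δ ⟩
  ∀R : ∀ {R T Γ Δ Δ₀ w u y φ} → Ok ⟨ R , T , Γ ⊢ Δ ⟩ →
       Δ ↭ (w , ∀ᶠ φ) ∷ Δ₀ → FreshLabel u ⟨ R , T , Γ ⊢ Δ ⟩ →
       FreshVar y ⟨ R , T , Γ ⊢ Δ ⟩ →
       Der ds? Ok ⟨ (w , u) ∷ R , (u , y) ∷ T , Γ ⊢ (u , φ [ var y ]) ∷ Δ₀ ⟩ →
       Der ds? Ok ⟨ R , T , Γ ⊢ Δ ⟩
  ds : ∀ {R T Γ Δ w p ts} → ds? ≡ true → Ok ⟨ R , T , Γ ⊢ Δ ⟩ →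
       (w , atom p ts) ∈ Γ →
       Der ds? Ok ⟨ R , domAtoms w ts ++ T , Γ ⊢ Δ ⟩ →
       Der ds? Ok ⟨ R , T , Γ ⊢ Δ ⟩

LBIQ⊢ : Seq → Set
LBIQ⊢ = Der true IsSequent

NIQ⊢ : Seq → Set
NIQ⊢ = Der false IsIntuitionistic

-- The calculi differ only in the rule (ds) and in the side condition on sequents, so every
-- NIQ(ID)-proof is an LBIQ(ID)-proof.  Conversely, in an LBIQ(ID)-proof of an intuitionistic
-- sequent, (ds) only adds domain atoms w:x for variables x that are already available at w
-- (x occurs in an atom w:p(t) whose free variables are available).  Deleting these atoms
-- throughout the proof leaves availability unchanged, so every rule instance remains valid;
-- and the sequents that arise stay intuitionistic: exclusion never occurs, the fresh labels of
-- (→R) and (∀R) grow the tree at a leaf, and eigenvariables are fresh.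
module Submission where

open import Defs
open import Function.Bundles using (_⇔_; mk⇔)
open import Function using (_∘_)
open import Data.Fin using (Fin; zero; suc)
open import Data.List using (List; []; _∷_; _++_; map)
open import Data.List.Membership.Propositional using (_∈_; _∉_)
open import Data.List.Membership.Propositional.Properties
  using (∈-++⁺ˡ; ∈-++⁺ʳ; ∈-++⁻; ∈-map⁺; ∈-map⁻)
open import Data.List.Relation.Unary.Any using (here; there)
open import Data.List.Relation.Unary.All as All using (All; _∷_)
import Data.List.Relation.Unary.All.Properties as Allₚ
open import Data.List.Relation.Binary.Subset.Propositional using (_⊆_)
open import Data.List.Relation.Binary.Subset.Propositional.Properties
  using (⊆-refl; xs⊆xs++ys; xs⊆ys++xs; ++⁺; ++⁺ˡ; ++⁺ʳ; map⁺; ∷⁺ʳ)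
open import Data.List.Relation.Binary.Permutation.Propositional using (_↭_; ↭-sym)
open import Data.List.Relation.Binary.Permutation.Propositional.Properties
  using (All-resp-↭; ∈-resp-↭)
open import Data.Product using (_,_; proj₁; proj₂)
open import Data.Sum using (_⊎_; inj₁; inj₂; [_,_]′)
open import Data.Bool using (true)
open import Data.Empty using (⊥-elim)
open import Data.Unit using (tt)
open import Relation.Binary.PropositionalEquality using (_≡_; refl; sym; trans)
open import Relation.Binary.Construct.Closure.ReflexiveTransitive using (ε; _◅_; _◅◅_)
import Relation.Binary.Construct.Closure.ReflexiveTransitive as Star

mutual
  VT-renT : ∀ {n m} (ρ : Fin n → Fin m) (t : Tm n) → VT (renT ρ t) ⊆ VT t
  VT-renT ρ (var x) = ⊆-refl
  VT-renT ρ (bvar i) ()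
  VT-renT ρ (fun f ts) = VTs-renTs ρ ts

  VTs-renTs : ∀ {n m} (ρ : Fin n → Fin m) (ts : List (Tm n)) →
              VTs (renTs ρ ts) ⊆ VTs ts
  VTs-renTs ρ [] ()
  VTs-renTs ρ (t ∷ ts) = ++⁺ (VT-renT ρ t) (VTs-renTs ρ ts)

++-⊆-merge : ∀ {A B V : List Var} (C D : List Var) →
             A ⊆ C ++ V → B ⊆ D ++ V → A ++ B ⊆ (C ++ D) ++ V
++-⊆-merge {A} {V = V} C D f g m with ∈-++⁻ A m
... | inj₁ a = ++⁺ˡ V (xs⊆xs++ys C D) (f a)
... | inj₂ b = ++⁺ˡ V (xs⊆ys++xs D C) (g b)

module _ {V : List Var} where

  mutual
    VT-subT : ∀ {n m} (σ : Fin n → Tm m) → (∀ i → VT (σ i) ⊆ V) →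
              (t : Tm n) → VT (subT σ t) ⊆ VT t ++ V
    VT-subT σ h (var x) = xs⊆xs++ys _ V
    VT-subT σ h (bvar i) = h i
    VT-subT σ h (fun f ts) = VTs-subTs σ h ts

    VTs-subTs : ∀ {n m} (σ : Fin n → Tm m) → (∀ i → VT (σ i) ⊆ V) →
                (ts : List (Tm n)) → VTs (subTs σ ts) ⊆ VTs ts ++ V
    VTs-subTs σ h [] ()
    VTs-subTs σ h (t ∷ ts) = ++-⊆-merge (VT t) (VTs ts) (VT-subT σ h t) (VTs-subTs σ h ts)

  VT-lift : ∀ {n m} (σ : Fin n → Tm m) → (∀ i → VT (σ i) ⊆ V) →
            ∀ i → VT (lift σ i) ⊆ V
  VT-lift σ h zero ()
  VT-lift σ h (suc i) = h i ∘ VT-renT suc (σ i)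

  FV-subF : ∀ {n m} (σ : Fin n → Tm m) → (∀ i → VT (σ i) ⊆ V) →
            (φ : Fm n) → FV (subF σ φ) ⊆ FV φ ++ V
  FV-subF σ h (atom p ts) = VTs-subTs σ h ts
  FV-subF σ h ⊥ᶠ ()
  FV-subF σ h ⊤ᶠ ()
  FV-subF σ h (φ ∧ᶠ ψ) = ++-⊆-merge (FV φ) (FV ψ) (FV-subF σ h φ) (FV-subF σ h ψ)
  FV-subF σ h (φ ∨ᶠ ψ) = ++-⊆-merge (FV φ) (FV ψ) (FV-subF σ h φ) (FV-subF σ h ψ)
  FV-subF σ h (φ -< ψ) = ++-⊆-merge (FV φ) (FV ψ) (FV-subF σ h φ) (FV-subF σ h ψ)
  FV-subF σ h (φ ⇒ ψ) = ++-⊆-merge (FV φ) (FV ψ) (FV-subF σ h φ) (FV-subF σ h ψ)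
  FV-subF σ h (∃ᶠ φ) = FV-subF (lift σ) (VT-lift σ h) φ
  FV-subF σ h (∀ᶠ φ) = FV-subF (lift σ) (VT-lift σ h) φ

FV-[] : ∀ (φ : Fm 1) t → FV (φ [ t ]) ⊆ FV φ ++ VT t
FV-[] φ t = FV-subF (λ _ → t) (λ _ → ⊆-refl) φ

IntFm-subF : ∀ {n m} (σ : Fin n → Tm m) (φ : Fm n) → IntFm φ → IntFm (subF σ φ)
IntFm-subF σ (atom p ts) i = tt
IntFm-subF σ ⊥ᶠ i = tt
IntFm-subF σ ⊤ᶠ i = tt
IntFm-subF σ (φ ∧ᶠ ψ) (i , j) = IntFm-subF σ φ i , IntFm-subF σ ψ j
IntFm-subF σ (φ ∨ᶠ ψ) (i , j) = IntFm-subF σ φ i , IntFm-subF σ ψ j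
IntFm-subF σ (φ ⇒ ψ) (i , j) = IntFm-subF σ φ i , IntFm-subF σ ψ j
IntFm-subF σ (∃ᶠ φ) i = IntFm-subF (lift σ) φ i
IntFm-subF σ (∀ᶠ φ) i = IntFm-subF (lift σ) φ i

-- x ∈ X_w; InX reads only the R and T of its sequent.
X : List RelAtom → List DomAtom → Label → Var → Set
X R T = InX ⟨ R , T , [] ⊢ [] ⟩

Reach-mono : ∀ {R R'} → R ⊆ R' → ∀ {w u} → Reach R w u → Reach R' w u
Reach-mono sub = Star.map sub

X-mono : ∀ {R R' T T'} → R ⊆ R' → T ⊆ T' → ∀ {w x} → X R T w x → X R' T' w x
X-mono subR subT (u , ux , r) = u , subT ux , Reach-mono subR r

X-here : ∀ {R T w y} → X R ((w , y) ∷ T) w y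
X-here {w = w} = w , here refl , ε

X-reach : ∀ {R T w v x} → X R T w x → Reach R w v → X R T v x
X-reach (u , ux , r) r' = u , ux , r ◅◅ r'

record WellFormed (R : List RelAtom) (T : List DomAtom) (a : LFm) : Set where
  constructor wf
  field
    intuitionistic : IntFm (proj₂ a)
    scoped : ∀ {x} → x ∈ FV (proj₂ a) → X R T (proj₁ a) x
open WellFormed

WellFormed-mono : ∀ {R R' T T'} → R ⊆ R' → T ⊆ T' →
                  ∀ {a} → WellFormed R T a → WellFormed R' T' a
WellFormed-mono subR subT (wf i s) = wf i (X-mono subR subT ∘ s)

WellFormed-reach : ∀ {R T w v φ} → WellFormed R T (w , φ) → Reach R w v →
                   WellFormed R T (v , φ)
WellFormed-reach (wf i s) r = wf i (λ m → X-reach (s m) r)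

WellFormed-sub : ∀ {R T w φ ψ} → (IntFm ψ → IntFm φ) → FV φ ⊆ FV ψ →
                 WellFormed R T (w , ψ) → WellFormed R T (w , φ)
WellFormed-sub int fv (wf i s) = wf (int i) (s ∘ fv)

WellFormed-[] : ∀ {R T w} {φ : Fm 1} {t} → IntFm φ → (∀ {x} → x ∈ FV φ → X R T w x) →
                (∀ {x} → x ∈ VT t → X R T w x) → WellFormed R T (w , φ [ t ])
WellFormed-[] {φ = φ} {t} i sφ st =
  wf (IntFm-subF (λ _ → t) φ i) (λ m → [ sφ , st ]′ (∈-++⁻ (FV φ) (FV-[] φ t m)))

UniqueDomain : List DomAtom → Set
UniqueDomain T = ∀ w z x → (w , x) ∈ T → (z , x) ∈ T → w ≡ z

UniqueDomain-∷ : ∀ {T w y} → UniqueDomain T → y ∉ map proj₂ T →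
                 UniqueDomain ((w , y) ∷ T)
UniqueDomain-∷ U new w z x (here refl) (here refl) = refl
UniqueDomain-∷ U new w z x (here refl) (there m) = ⊥-elim (new (∈-map⁺ proj₂ m))
UniqueDomain-∷ U new w z x (there m) (here refl) = ⊥-elim (new (∈-map⁺ proj₂ m))
UniqueDomain-∷ U new w z x (there m) (there n) = U w z x m n

RootedTree-extend : ∀ {R w} u → R ≡ [] ⊎ w ∈ labelsR R → RootedTree R →
                    RootedTree ((w , u) ∷ R)
RootedTree-extend {[]} {w} u _ _ = w , reach
  where
  reach : ∀ v → v ∈ labelsR ((w , u) ∷ []) → Reach ((w , u) ∷ []) w v
  reach v (here refl) = ε
  reach v (there (here refl)) = here refl ◅ ε
RootedTree-extend {e ∷ R} {w} u (inj₂ w∈R) (r , reach) = r , reach'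
  where
  r↠w : Reach ((w , u) ∷ e ∷ R) r w
  r↠w = Reach-mono there (reach w w∈R)
  reach' : ∀ v → v ∈ labelsR ((w , u) ∷ e ∷ R) → Reach ((w , u) ∷ e ∷ R) r v
  reach' v (here refl) = r↠w
  reach' v (there (here refl)) = r↠w ◅◅ (here refl ◅ ε)
  reach' v (there (there m)) = Reach-mono there (reach v m)

FormulaLabel : List LFm → List LFm → Label → Set
FormulaLabel Γ Δ w = w ∈ map proj₁ Γ ⊎ w ∈ map proj₁ Δ

FormulaLabel⇒labelsTΓΔ : ∀ (T : List DomAtom) {Γ Δ w} → FormulaLabel Γ Δ w →
                         w ∈ map proj₁ T ++ map proj₁ Γ ++ map proj₁ Δ
FormulaLabel⇒labelsTΓΔ T {Γ} =
  ∈-++⁺ʳ (map proj₁ T) ∘ [ ∈-++⁺ˡ , ∈-++⁺ʳ (map proj₁ Γ) ]′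

LabelCond-vertex : ∀ {R T Γ Δ w} → LabelCond ⟨ R , T , Γ ⊢ Δ ⟩ → FormulaLabel Γ Δ w →
                   R ≡ [] ⊎ w ∈ labelsR R
LabelCond-vertex {[]} lc wl = inj₁ refl
LabelCond-vertex {_ ∷ _} {T} {w = w} lc wl = inj₂ (lc w (FormulaLabel⇒labelsTΓΔ T wl))

-- Shrinking T can empty the labels of a sequent with R = ∅, hence the label witness.
LabelCond-⊆ : ∀ {R T T' Γ Δ w} → T ⊆ T' → FormulaLabel Γ Δ w →
              LabelCond ⟨ R , T' , Γ ⊢ Δ ⟩ → LabelCond ⟨ R , T , Γ ⊢ Δ ⟩
LabelCond-⊆ {[]} {T} {T'} {Γ} {Δ} {w} sub wl (v , _ , all≡v) =
  w , w∈ , λ u u∈ → trans (all≡v u (grow u∈)) (sym (all≡v w (grow w∈)))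
  where
  w∈ : w ∈ labelsTΓΔ ⟨ [] , T , Γ ⊢ Δ ⟩
  w∈ = FormulaLabel⇒labelsTΓΔ T wl
  grow : labelsTΓΔ ⟨ [] , T , Γ ⊢ Δ ⟩ ⊆ labelsTΓΔ ⟨ [] , T' , Γ ⊢ Δ ⟩
  grow = ++⁺ˡ (map proj₁ Γ ++ map proj₁ Δ) (map⁺ proj₁ sub)
LabelCond-⊆ {_ ∷ _} {Γ = Γ} {Δ} sub wl lc u u∈ =
  lc u (++⁺ˡ (map proj₁ Γ ++ map proj₁ Δ) (map⁺ proj₁ sub) u∈)

-- IsIntuitionistic minus IsSequent, which each premise inherits from the LBIQ(ID)-proof.
record IntConditions (R : List RelAtom) (T : List DomAtom) (Γ Δ : List LFm) : Set where
  field
    rooted : RootedTree R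
    uniqueDomain : UniqueDomain T
    wellFormedΓ : All (WellFormed R T) Γ
    wellFormedΔ : All (WellFormed R T) Δ
open IntConditions

withΓ : ∀ {R T Γ Γ' Δ} → All (WellFormed R T) Γ' →
        IntConditions R T Γ Δ → IntConditions R T Γ' Δ
withΓ ws c = record
  { rooted = rooted c ; uniqueDomain = uniqueDomain c
  ; wellFormedΓ = ws ; wellFormedΔ = wellFormedΔ c }

withΔ : ∀ {R T Γ Δ Δ'} → All (WellFormed R T) Δ' →
        IntConditions R T Γ Δ → IntConditions R T Γ Δ'
withΔ ws c = record
  { rooted = rooted c ; uniqueDomain = uniqueDomain c
  ; wellFormedΓ = wellFormedΓ c ; wellFormedΔ = ws }

intConditions : ∀ {R T Γ Δ} → IsIntuitionistic ⟨ R , T , Γ ⊢ Δ ⟩ → IntConditions R T Γ Δ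
intConditions {R} {T} {Γ} {Δ} (_ , rt , int , scoped , U) = record
  { rooted = rt
  ; uniqueDomain = U
  ; wellFormedΓ = Allₚ.++⁻ˡ Γ all
  ; wellFormedΔ = Allₚ.++⁻ʳ Γ all
  }
  where
  all : All (WellFormed R T) (Γ ++ Δ)
  all = All.tabulate λ { {w , φ} m → wf (int w φ m) (scoped w φ _ m) }

isIntuitionistic : ∀ {R T T' Γ Δ w} → IsSequent ⟨ R , T' , Γ ⊢ Δ ⟩ → T ⊆ T' →
                   FormulaLabel Γ Δ w → IntConditions R T Γ Δ →
                   IsIntuitionistic ⟨ R , T , Γ ⊢ Δ ⟩
isIntuitionistic {R} {T} {Γ = Γ} {Δ} (lc , graph) sub wl c =
  (LabelCond-⊆ sub wl lc , graph) , rooted c ,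
  (λ w φ m → intuitionistic (All.lookup all m)) , (λ w φ x m → scoped (All.lookup all m)) ,
  uniqueDomain c
  where
  all : All (WellFormed R T) (Γ ++ Δ)
  all = Allₚ.++⁺ (wellFormedΓ c) (wellFormedΔ c)

RootedTree-extendΔ : ∀ {R T Γ Δ w φ} u → IsIntuitionistic ⟨ R , T , Γ ⊢ Δ ⟩ → (w , φ) ∈ Δ →
                     RootedTree ((w , u) ∷ R)
RootedTree-extendΔ u ((lc , _) , rt , _) m =
  RootedTree-extend u (LabelCond-vertex lc (inj₂ (∈-map⁺ proj₁ m))) rt

record DsExtension (R : List RelAtom) (T T' : List DomAtom) : Set where
  field
    kept : T ⊆ T'
    redundant : ∀ {w x} → (w , x) ∈ T' → X R T w x
open DsExtension

DsExtension-refl : ∀ {R T} → DsExtension R T T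
DsExtension-refl = record { kept = ⊆-refl ; redundant = λ {w} m → w , m , ε }

DsExtension-growR : ∀ {R R' T T'} → R ⊆ R' → DsExtension R T T' → DsExtension R' T T'
DsExtension-growR sub e = record { kept = kept e ; redundant = X-mono sub ⊆-refl ∘ redundant e }

DsExtension-∷ : ∀ {R T T' w y} → DsExtension R T T' →
                DsExtension R ((w , y) ∷ T) ((w , y) ∷ T')
DsExtension-∷ {R} {T} {T'} {w} {y} e =
  record { kept = ∷⁺ʳ (w , y) (kept e) ; redundant = redundant' }
  where
  redundant' : ∀ {v x} → (v , x) ∈ (w , y) ∷ T' → X R ((w , y) ∷ T) v x
  redundant' (here refl) = X-here
  redundant' (there m) = X-mono ⊆-refl there (redundant e m)

DsExtension-ds : ∀ {R T T' w p ts} → WellFormed R T (w , atom p ts) →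
                 DsExtension R T T' → DsExtension R T (domAtoms w ts ++ T')
DsExtension-ds {R} {T} {T'} {w} {ts = ts} wf-p e =
  record { kept = xs⊆ys++xs T' (domAtoms w ts) ∘ kept e ; redundant = redundant' }
  where
  redundant' : ∀ {v x} → (v , x) ∈ domAtoms w ts ++ T' → X R T v x
  redundant' m with ∈-++⁻ (domAtoms w ts) m
  ... | inj₂ m' = redundant e m'
  ... | inj₁ m' with ∈-map⁻ (λ x → (w , x)) m'
  ...   | x , x∈ts , refl = scoped wf-p x∈ts

X-ds : ∀ {R T T' w x} → DsExtension R T T' → X R T' w x → X R T w x
X-ds e (u , ux , r) = X-reach (redundant e ux) r

FreshLabel-ds : ∀ {R T T'} Γ Δ {u} → DsExtension R T T' →
                FreshLabel u ⟨ R , T' , Γ ⊢ Δ ⟩ → FreshLabel u ⟨ R , T , Γ ⊢ Δ ⟩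
FreshLabel-ds {R} Γ Δ e fresh =
  fresh ∘ ++⁺ʳ (labelsR R) (++⁺ˡ (map proj₁ Γ ++ map proj₁ Δ) (map⁺ proj₁ (kept e)))

FreshVar-ds : ∀ {R T T'} Γ Δ {y} → DsExtension R T T' →
              FreshVar y ⟨ R , T' , Γ ⊢ Δ ⟩ → FreshVar y ⟨ R , T , Γ ⊢ Δ ⟩
FreshVar-ds Γ Δ e fresh = fresh ∘ ++⁺ˡ _ (map⁺ proj₂ (kept e))

Der-ok : ∀ {b Ok S} → Der b Ok S → Ok S
Der-ok (ax o _ _ _) = o
Der-ok (⊥L o _) = o
Der-ok (⊤R o _) = o
Der-ok (∧L o _ _) = o
Der-ok (∧R o _ _ _) = o
Der-ok (∨L o _ _ _) = o
Der-ok (∨R o _ _) = o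
Der-ok (⇒L o _ _ _ _) = o
Der-ok (⇒R o _ _ _) = o
Der-ok (-<L o _ _ _) = o
Der-ok (-<R o _ _ _ _) = o
Der-ok (∃L o _ _ _) = o
Der-ok (∃R o _ _ _) = o
Der-ok (∀L o _ _ _ _) = o
Der-ok (∀R o _ _ _ _) = o
Der-ok (ds _ o _ _) = o

Der-mono : ∀ {b b' Ok Ok'} → (b ≡ true → b' ≡ true) → (∀ {S} → Ok S → Ok' S) →
           ∀ {S} → Der b Ok S → Der b' Ok' S
Der-mono ds⇒ ok⇒ (ax o a b r) = ax (ok⇒ o) a b r
Der-mono ds⇒ ok⇒ (⊥L o a) = ⊥L (ok⇒ o) a
Der-mono ds⇒ ok⇒ (⊤R o a) = ⊤R (ok⇒ o) a
Der-mono ds⇒ ok⇒ (∧L o p d) = ∧L (ok⇒ o) p (Der-mono ds⇒ ok⇒ d)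
Der-mono ds⇒ ok⇒ (∧R o p d e) =
  ∧R (ok⇒ o) p (Der-mono ds⇒ ok⇒ d) (Der-mono ds⇒ ok⇒ e)
Der-mono ds⇒ ok⇒ (∨L o p d e) =
  ∨L (ok⇒ o) p (Der-mono ds⇒ ok⇒ d) (Der-mono ds⇒ ok⇒ e)
Der-mono ds⇒ ok⇒ (∨R o p d) = ∨R (ok⇒ o) p (Der-mono ds⇒ ok⇒ d)
Der-mono ds⇒ ok⇒ (⇒L o a r d e) =
  ⇒L (ok⇒ o) a r (Der-mono ds⇒ ok⇒ d) (Der-mono ds⇒ ok⇒ e)
Der-mono ds⇒ ok⇒ (⇒R o p f d) = ⇒R (ok⇒ o) p f (Der-mono ds⇒ ok⇒ d)
Der-mono ds⇒ ok⇒ (-<L o p f d) = -<L (ok⇒ o) p f (Der-mono ds⇒ ok⇒ d)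
Der-mono ds⇒ ok⇒ (-<R o a r d e) =
  -<R (ok⇒ o) a r (Der-mono ds⇒ ok⇒ d) (Der-mono ds⇒ ok⇒ e)
Der-mono ds⇒ ok⇒ (∃L o p f d) = ∃L (ok⇒ o) p f (Der-mono ds⇒ ok⇒ d)
Der-mono ds⇒ ok⇒ (∃R o a av d) = ∃R (ok⇒ o) a av (Der-mono ds⇒ ok⇒ d)
Der-mono ds⇒ ok⇒ (∀L o a r av d) = ∀L (ok⇒ o) a r av (Der-mono ds⇒ ok⇒ d)
Der-mono ds⇒ ok⇒ (∀R o p f g d) = ∀R (ok⇒ o) p f g (Der-mono ds⇒ ok⇒ d)
Der-mono ds⇒ ok⇒ (ds on o a d) = ds (ds⇒ on) (ok⇒ o) a (Der-mono ds⇒ ok⇒ d)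

NIQ⊢⇒LBIQ⊢ : ∀ {S} → NIQ⊢ S → LBIQ⊢ S
NIQ⊢⇒LBIQ⊢ = Der-mono (λ ()) proj₁

∈-↭-head : ∀ {A : Set} {a : A} {xs ys} → xs ↭ a ∷ ys → a ∈ xs
∈-↭-head p = ∈-resp-↭ (↭-sym p) (here refl)

mutual
  eraseDs : ∀ {R T T' Γ Δ} → LBIQ⊢ ⟨ R , T' , Γ ⊢ Δ ⟩ → DsExtension R T T' →
            IsIntuitionistic ⟨ R , T , Γ ⊢ Δ ⟩ → IntConditions R T Γ Δ →
            NIQ⊢ ⟨ R , T , Γ ⊢ Δ ⟩
  eraseDs (ax _ a b r) e int c = ax int a b r
  eraseDs (⊥L _ a) e int c = ⊥L int a
  eraseDs (⊤R _ a) e int c = ⊤R int a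
  eraseDs (∧L {φ = φ} _ p d) e int c =
    ∧L int p (eraseDs-premise d e (inj₁ (here refl)) (withΓ (gˡ ∷ gʳ ∷ All.tail Γ') c))
    where
    Γ' = All-resp-↭ p (wellFormedΓ c)
    gˡ = WellFormed-sub proj₁ ∈-++⁺ˡ (All.head Γ')
    gʳ = WellFormed-sub proj₂ (∈-++⁺ʳ (FV φ)) (All.head Γ')
  eraseDs (∧R {φ = φ} _ p d d') e int c =
    ∧R int p (eraseDs-premise d e (inj₂ (here refl)) (withΔ (gˡ ∷ All.tail Δ') c))
             (eraseDs-premise d' e (inj₂ (here refl)) (withΔ (gʳ ∷ All.tail Δ') c))
    where
    Δ' = All-resp-↭ p (wellFormedΔ c)
    gˡ = WellFormed-sub proj₁ ∈-++⁺ˡ (All.head Δ')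
    gʳ = WellFormed-sub proj₂ (∈-++⁺ʳ (FV φ)) (All.head Δ')
  eraseDs (∨L {φ = φ} _ p d d') e int c =
    ∨L int p (eraseDs-premise d e (inj₁ (here refl)) (withΓ (gˡ ∷ All.tail Γ') c))
             (eraseDs-premise d' e (inj₁ (here refl)) (withΓ (gʳ ∷ All.tail Γ') c))
    where
    Γ' = All-resp-↭ p (wellFormedΓ c)
    gˡ = WellFormed-sub proj₁ ∈-++⁺ˡ (All.head Γ')
    gʳ = WellFormed-sub proj₂ (∈-++⁺ʳ (FV φ)) (All.head Γ')
  eraseDs (∨R {φ = φ} _ p d) e int c =
    ∨R int p (eraseDs-premise d e (inj₂ (here refl)) (withΔ (gˡ ∷ gʳ ∷ All.tail Δ') c))
    where
    Δ' = All-resp-↭ p (wellFormedΔ c)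
    gˡ = WellFormed-sub proj₁ ∈-++⁺ˡ (All.head Δ')
    gʳ = WellFormed-sub proj₂ (∈-++⁺ʳ (FV φ)) (All.head Δ')
  eraseDs (⇒L {φ = φ} _ m r d d') e int c =
    ⇒L int m r (eraseDs-premise d e (inj₂ (here refl)) (withΔ (gˡ ∷ wellFormedΔ c) c))
               (eraseDs-premise d' e (inj₁ (here refl)) (withΓ (gʳ ∷ wellFormedΓ c) c))
    where
    g = WellFormed-reach (All.lookup (wellFormedΓ c) m) r
    gˡ = WellFormed-sub proj₁ ∈-++⁺ˡ g
    gʳ = WellFormed-sub proj₂ (∈-++⁺ʳ (FV φ)) g
  eraseDs {Γ = Γ} {Δ} (⇒R {u = u} {φ = φ} _ p fresh d) e int c =
    ⇒R int p (FreshLabel-ds Γ Δ e fresh)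
      (eraseDs-premise d (DsExtension-growR there e) (inj₁ (here refl)) record
        { rooted = RootedTree-extendΔ u int (∈-↭-head p)
        ; uniqueDomain = uniqueDomain c
        ; wellFormedΓ = gˡ ∷ All.map (WellFormed-mono there ⊆-refl) (wellFormedΓ c)
        ; wellFormedΔ = gʳ ∷ All.map (WellFormed-mono there ⊆-refl) (All.tail Δ')
        })
    where
    Δ' = All-resp-↭ p (wellFormedΔ c)
    g = WellFormed-reach (WellFormed-mono there ⊆-refl (All.head Δ')) (here refl ◅ ε)
    gˡ = WellFormed-sub proj₁ ∈-++⁺ˡ g
    gʳ = WellFormed-sub proj₂ (∈-++⁺ʳ (FV φ)) g
  eraseDs (-<L _ p _ _) e int c =
    ⊥-elim (intuitionistic (All.head (All-resp-↭ p (wellFormedΓ c))))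
  eraseDs (-<R _ m _ _ _) e int c = ⊥-elim (intuitionistic (All.lookup (wellFormedΔ c) m))
  eraseDs {Γ = Γ} {Δ} (∃L _ p fresh d) e int c =
    ∃L int p fresh'
      (eraseDs-premise d (DsExtension-∷ e) (inj₁ (here refl)) record
        { rooted = rooted c
        ; uniqueDomain = UniqueDomain-∷ (uniqueDomain c) (fresh' ∘ ∈-++⁺ˡ)
        ; wellFormedΓ = WellFormed-[] (intuitionistic g) (scoped g) (λ { (here refl) → X-here })
                        ∷ All.map (WellFormed-mono ⊆-refl there) (All.tail Γ')
        ; wellFormedΔ = All.map (WellFormed-mono ⊆-refl there) (wellFormedΔ c)
        })
    where
    fresh' = FreshVar-ds Γ Δ e fresh
    Γ' = All-resp-↭ p (wellFormedΓ c)
    g = WellFormed-mono ⊆-refl there (All.head Γ')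
  eraseDs (∃R _ m av d) e int c =
    ∃R int m (λ x → X-ds e ∘ av x) (eraseDs-premise d e (inj₂ (here refl))
      (withΔ (WellFormed-[] (intuitionistic g) (scoped g) (X-ds e ∘ av _) ∷ wellFormedΔ c) c))
    where
    g = All.lookup (wellFormedΔ c) m
  eraseDs (∀L _ m r av d) e int c =
    ∀L int m r (λ x → X-ds e ∘ av x) (eraseDs-premise d e (inj₁ (here refl))
      (withΓ (WellFormed-[] (intuitionistic g) (scoped g) (X-ds e ∘ av _) ∷ wellFormedΓ c) c))
    where
    g = WellFormed-reach (All.lookup (wellFormedΓ c) m) r
  eraseDs {Γ = Γ} {Δ} (∀R {u = u} _ p freshu freshy d) e int c =
    ∀R int p (FreshLabel-ds Γ Δ e freshu) freshy'
      (eraseDs-premise d (DsExtension-∷ (DsExtension-growR there e)) (inj₂ (here refl)) record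
        { rooted = RootedTree-extendΔ u int (∈-↭-head p)
        ; uniqueDomain = UniqueDomain-∷ (uniqueDomain c) (freshy' ∘ ∈-++⁺ˡ)
        ; wellFormedΓ = All.map (WellFormed-mono there there) (wellFormedΓ c)
        ; wellFormedΔ = WellFormed-[] (intuitionistic g) (scoped g) (λ { (here refl) → X-here })
                        ∷ All.map (WellFormed-mono there there) (All.tail Δ')
        })
    where
    freshy' = FreshVar-ds Γ Δ e freshy
    Δ' = All-resp-↭ p (wellFormedΔ c)
    g = WellFormed-reach (WellFormed-mono there there (All.head Δ')) (here refl ◅ ε)
  eraseDs (ds refl _ m d) e int c =
    eraseDs d (DsExtension-ds (All.lookup (wellFormedΓ c) m) e) int c

  eraseDs-premise : ∀ {R T T' Γ Δ w} → LBIQ⊢ ⟨ R , T' , Γ ⊢ Δ ⟩ → DsExtension R T T' →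
                    FormulaLabel Γ Δ w → IntConditions R T Γ Δ → NIQ⊢ ⟨ R , T , Γ ⊢ Δ ⟩
  eraseDs-premise d e wl c = eraseDs d e (isIntuitionistic (Der-ok d) (kept e) wl c) c

LBIQ⊢⇒NIQ⊢ : ∀ {S} → IsIntuitionistic S → LBIQ⊢ S → NIQ⊢ S
LBIQ⊢⇒NIQ⊢ int d = eraseDs d DsExtension-refl int (intConditions int)

lemma26 : (S : Seq) → IsIntuitionistic S → (NIQ⊢ S ⇔ LBIQ⊢ S)
lemma26 S int = mk⇔ NIQ⊢⇒LBIQ⊢ (LBIQ⊢⇒NIQ⊢ int)
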